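{- GBSR properly contains the separated fragment, the BSR fragment, and the relational monadic fragment without equality; that is, every sentence (in standard form) of each of these three fragments belongs to GBSR, and there are GBSR sentences belonging to none of them.
   Context: A first-order sentence $\varphi$ is in standard form if $\varphi = \forall \vec{x}_1 \exists \vec{y}_1 \ldots \forall \vec{x}_n \exists \vec{y}_n.\,\psi$, where the $\vec{x}_i,\vec{y}_i$ are tuples of variables ($\vec{x}_1$ and $\vec{y}_n$ may be empty), $\psi$ is quantifier-free, in negation normal form and uses only $\wedge,\vee,\neg$, every variable bound in the prefix occurs in $\psi$, and no variable is bound twice. Write $\vec{x} := \bigcup_i\vec{x}_i$, $\vec{y}:=\bigcup_i\vec{y}_i$, let $\mathrm{At}$ be the set of atoms, and $\mathrm{vars}(S)$ the set of variables occurring in a set $S$ of atoms. A sentence in standard form that may contain equality and constant symbols but no non-constant function symbols belongs to GBSR iff $\mathrm{At}$ can be partitioned into (possibly empty) sets $\mathrm{At}_0,\ldots,\mathrm{At}_n$ such that (i) $\mathrm{vars}(\mathrm{At}_i)\subseteq \vec{y}_1\cup\ldots\cup\vec{y}_i\cup\vec{x}_{i+1}\cup\ldots\cup\vec{x}_n$ for all $0\le i\le n$, and (ii) $\mathrm{vars}(\mathrm{At}_i)\cap\mathrm{vars}(\mathrm{At}_j)\cap\vec{x}=\emptyset$ for all $0\le i<j\le n$. The BSR fragment consists of sentences $\exists\vec{u}\,\forall\vec{v}.\,\chi$ with $\chi$ quantifier-free, possibly with equality and constants but without non-constant function symbols. The separated fragment (SF) consists of sentences $\exists\vec{z}\,\forall\vec{u}_1\exists\vec{v}_1\ldots\forall\vec{u}_n\exists\vec{v}_n.\,\chi$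 with $\chi$ quantifier-free, possibly with equality and constants but no non-constant function symbols, such that every atom $A$ satisfies $\mathrm{vars}(A)\cap\bigcup_i\vec{u}_i=\emptyset$ or $\mathrm{vars}(A)\cap\bigcup_i\vec{v}_i=\emptyset$. The relational monadic fragment without equality consists of sentences without function, constant symbols and equality in which all predicate symbols are unary. -}

module Defs where

open import Data.Nat using (ℕ; zero; suc; _<_; _≤_)
open import Data.List using (List; []; _∷_; _++_; map; concatMap)
open import Data.List.Membership.Propositional using (_∈_; _∉_)
open import Data.List.Relation.Unary.Unique.Propositional using (Unique)
open import Data.List.Relation.Unary.All using (All)
open import Data.Product using (Σ; _×_; _,_; proj₂; ∃; ∃-syntax)
open import Data.Sum using (_⊎_)
open import Data.Unit using (⊤)
open import Data.Empty using (⊥)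
open import Relation.Nullary using (¬_)
open import Relation.Binary.PropositionalEquality using (_≡_; _≢_)

Var : Set
Var = ℕ

data Term : Set where
  var : Var → Term
  con : ℕ → Term

data Atom : Set where
  rel : ℕ → List Term → Atom
  eq  : Term → Term → Atom

data Formula : Set where
  atom : Atom → Formula
  neg  : Formula → Formula
  and  : Formula → Formula → Formula
  or   : Formula → Formula → Formula
  all  : Var → Formula → Formula
  ex   : Var → Formula → Formula

termVars : Term → List Var
termVars (var x) = x ∷ []
termVars (con _) = []

atomVars : Atom → List Var
atomVars (rel _ ts) = concatMap termVars ts
atomVars (eq s t)   = termVars s ++ termVars t

atoms : Formula → List Atom
atoms (atom a)  = a ∷ []
atoms (neg φ)   = atoms φ
atoms (and φ ψ) = atoms φ ++ atoms ψ
atoms (or φ ψ)  = atoms φ ++ atoms ψ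
atoms (all _ φ) = atoms φ
atoms (ex _ φ)  = atoms φ

varsOf : Formula → List Var
varsOf φ = concatMap atomVars (atoms φ)

data FreeIn (x : Var) : Formula → Set where
  atomF : ∀ {a} → x ∈ atomVars a → FreeIn x (atom a)
  negF  : ∀ {φ} → FreeIn x φ → FreeIn x (neg φ)
  andL  : ∀ {φ ψ} → FreeIn x φ → FreeIn x (and φ ψ)
  andR  : ∀ {φ ψ} → FreeIn x ψ → FreeIn x (and φ ψ)
  orL   : ∀ {φ ψ} → FreeIn x φ → FreeIn x (or φ ψ)
  orR   : ∀ {φ ψ} → FreeIn x ψ → FreeIn x (or φ ψ)
  allF  : ∀ {y φ} → x ≢ y → FreeIn x φ → FreeIn x (all y φ)
  exF   : ∀ {y φ} → x ≢ y → FreeIn x φ → FreeIn x (ex y φ)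

Closed : Formula → Set
Closed φ = ∀ x → ¬ FreeIn x φ

QuantifierFree : Formula → Set
QuantifierFree (atom _)  = ⊤
QuantifierFree (neg φ)   = QuantifierFree φ
QuantifierFree (and φ ψ) = QuantifierFree φ × QuantifierFree ψ
QuantifierFree (or φ ψ)  = QuantifierFree φ × QuantifierFree ψ
QuantifierFree (all _ _) = ⊥
QuantifierFree (ex _ _)  = ⊥

NNF : Formula → Set
NNF (atom _)        = ⊤
NNF (neg (atom _))  = ⊤
NNF (neg _)         = ⊥
NNF (and φ ψ)       = NNF φ × NNF ψ
NNF (or φ ψ)        = NNF φ × NNF ψ
NNF (all _ φ)       = NNF φ
NNF (ex _ φ)        = NNF φ

data Q : Set where
  ∀q ∃q : Q

Prefix : Set
Prefix = List (Q × Var)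

prenex : Prefix → Formula → Formula
prenex []              χ = χ
prenex ((∀q , x) ∷ p) χ = all x (prenex p χ)
prenex ((∃q , x) ∷ p) χ = ex x (prenex p χ)

univVars : Prefix → List Var
univVars []             = []
univVars ((∀q , x) ∷ p) = x ∷ univVars p
univVars ((∃q , _) ∷ p) = univVars p

existVars : Prefix → List Var
existVars []             = []
existVars ((∀q , _) ∷ p) = existVars p
existVars ((∃q , y) ∷ p) = y ∷ existVars p

-- Conditions making  prenex p χ  a sentence in standard form
-- (any prefix has the shape ∀x₁∃y₁…∀xₙ∃yₙ).
StdParts : Prefix → Formula → Set
StdParts p χ =
  QuantifierFree χ × NNF χ
  × Unique (map proj₂ p)
  × All (λ v → v ∈ varsOf χ) (map proj₂ p)
  × Closed (prenex p χ)

StandardForm : Formula → Set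
StandardForm φ = Σ Prefix λ p → Σ Formula λ χ → φ ≡ prenex p χ × StdParts p χ

-- Block indices of ∀x₁∃y₁…∀xₙ∃yₙ (x₁, yₙ possibly empty, all other
-- blocks nonempty): the index of a quantified variable is 1 plus the
-- number of ∃∀ alternations preceding it.

step : Q → Q → ℕ → ℕ
step ∃q ∀q k = suc k
step _  _  k = k

annotate : ℕ → Q → Prefix → List (Q × Var × ℕ)
annotate k prev []             = []
annotate k prev ((q , v) ∷ p) = (q , v , step prev q k) ∷ annotate (step prev q k) q p

numBlocks : ℕ → Q → Prefix → ℕ
numBlocks k prev []             = k
numBlocks k prev ((q , v) ∷ p) = numBlocks (step prev q k) q p

-- (q , v , i) ∈ blockIndex p  :  v ∈ x_i (q = ∀q) resp. v ∈ y_i (q = ∃q)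
blockIndex : Prefix → List (Q × Var × ℕ)
blockIndex p = annotate 1 ∀q p

blockCount : Prefix → ℕ
blockCount p = numBlocks 1 ∀q p

-- The partition At₀,…,Atₙ is given by a labelling f (At_i = {A | f A = i}).
GBSRParts : Prefix → Formula → Set
GBSRParts p χ = Σ (Atom → ℕ) λ f →
  (∀ A → A ∈ atoms χ → f A ≤ blockCount p)
  -- (i) vars(At_i) ⊆ y₁ ∪ … ∪ y_i ∪ x_{i+1} ∪ … ∪ xₙ
  × (∀ A → A ∈ atoms χ → ∀ v k → v ∈ atomVars A →
        ((∀q , v , k) ∈ blockIndex p → f A < k)
      × ((∃q , v , k) ∈ blockIndex p → k ≤ f A))
  -- (ii) vars(At_i) ∩ vars(At_j) ∩ x⃗ = ∅ for i ≠ j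
  × (∀ A B → A ∈ atoms χ → B ∈ atoms χ → ∀ v → v ∈ univVars p →
        v ∈ atomVars A → v ∈ atomVars B → f A ≡ f B)

GBSR : Formula → Set
GBSR φ = Σ Prefix λ p → Σ Formula λ χ →
  φ ≡ prenex p χ × StdParts p χ × GBSRParts p χ

BSR : Formula → Set
BSR φ = Σ (List Var) λ us → Σ (List Var) λ vs → Σ Formula λ χ →
  φ ≡ prenex (map (λ u → (∃q , u)) us ++ map (λ v → (∀q , v)) vs) χ
  × QuantifierFree χ × Closed φ

-- ∃z⃗ ∀u⃗₁∃v⃗₁…∀u⃗ₙ∃v⃗ₙ.χ : after the leading ∃z⃗ the remaining prefix
-- `rest` is arbitrary; u⃗ = univVars rest, v⃗ = existVars rest.
SF : Formula → Set
SF φ = Σ (List Var) λ zs → Σ Prefix λ rest → Σ Formula λ χ →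
  φ ≡ prenex (map (λ z → (∃q , z)) zs ++ rest) χ
  × QuantifierFree χ × Closed φ
  × All (λ A → (∀ v → v ∈ atomVars A → v ∉ univVars rest)
             ⊎ (∀ v → v ∈ atomVars A → v ∉ existVars rest)) (atoms χ)

Monadic : Formula → Set
Monadic φ = Closed φ × All (λ A → ∃[ P ] ∃[ x ] (A ≡ rel P (var x ∷ []))) (atoms φ)

-- In a separated sentence ∃z⃗ ∀u⃗₁∃v⃗₁…∀u⃗ₙ∃v⃗ₙ.χ no atom contains both some uᵢ
-- and some vⱼ: the atoms with a universal variable all go into the class of the
-- leading block (At₀, or At₁ when z⃗ is nonempty), the remaining atoms, whose
-- variables are all existential, into Atₙ.  BSR sentences are separated.
-- Otherwise give a variable of x⃗ₖ the level k − 1 and one of y⃗ₖ the level k, so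
-- that condition (i) holds for it in the class of its level.  An atom whose
-- variables share one level goes into that class, and condition (ii) is then
-- automatic.  Monadic atoms have a single variable, and in ∀x ∃y ∀x'. P(x) ∧ R(y, x')
-- both y and x' have level 1, so it is GBSR; R(y, x') keeps it from being
-- separated or monadic, and its ∀∃∀ prefix from being BSR.
module Submission where

open import Defs
open import Data.Nat using (ℕ; suc; _<_; _≤_; z≤n; pred; _≟_)
open import Data.Nat.Properties using (≤-refl; ≤-trans; n≤1+n; pred[n]≤n)
open import Data.List using (List; []; _∷_; _++_; map)
open import Data.List.Relation.Unary.Any using (Any; here; there; any?)
open import Data.List.Relation.Unary.All as All using (All; []; _∷_)
open import Data.List.Relation.Unary.AllPairs using ([]; _∷_)
open import Data.List.Relation.Unary.Unique.Propositional using (Unique)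
open import Data.List.Membership.Propositional using (_∈_; _∉_; lose; find)
open import Data.List.Membership.Propositional.Properties using (∈-map⁺)
open import Data.List.Membership.DecPropositional _≟_ using (_∈?_)
open import Data.Product using (_×_; _,_; proj₁; proj₂; ∃-syntax)
open import Data.Sum using (_⊎_; inj₁; inj₂)
open import Data.Unit using (tt)
open import Data.Empty using (⊥-elim)
open import Relation.Nullary using (¬_; yes; no)
open import Relation.Binary.PropositionalEquality using (_≡_; refl; sym; trans; cong; subst)

quantifierPrefix : Formula → Prefix
quantifierPrefix (all x φ) = (∀q , x) ∷ quantifierPrefix φ
quantifierPrefix (ex x φ)  = (∃q , x) ∷ quantifierPrefix φ
quantifierPrefix _         = []

matrix : Formula → Formula
matrix (all _ φ) = matrix φ
matrix (ex _ φ)  = matrix φ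
matrix φ         = φ

quantifierPrefix-prenex : ∀ p {χ} → QuantifierFree χ → quantifierPrefix (prenex p χ) ≡ p
quantifierPrefix-prenex [] {atom _}  _ = refl
quantifierPrefix-prenex [] {neg _}   _ = refl
quantifierPrefix-prenex [] {and _ _} _ = refl
quantifierPrefix-prenex [] {or _ _}  _ = refl
quantifierPrefix-prenex ((∀q , x) ∷ p) qf = cong ((∀q , x) ∷_) (quantifierPrefix-prenex p qf)
quantifierPrefix-prenex ((∃q , x) ∷ p) qf = cong ((∃q , x) ∷_) (quantifierPrefix-prenex p qf)

matrix-prenex : ∀ p {χ} → QuantifierFree χ → matrix (prenex p χ) ≡ χ
matrix-prenex [] {atom _}  _ = refl
matrix-prenex [] {neg _}   _ = refl
matrix-prenex [] {and _ _} _ = refl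
matrix-prenex [] {or _ _}  _ = refl
matrix-prenex ((∀q , _) ∷ p) qf = matrix-prenex p qf
matrix-prenex ((∃q , _) ∷ p) qf = matrix-prenex p qf

prenex-injective : ∀ {p p′ χ χ′} → QuantifierFree χ → QuantifierFree χ′ →
                   prenex p χ ≡ prenex p′ χ′ → p ≡ p′ × χ ≡ χ′
prenex-injective {p} {p′} qf qf′ e =
    trans (sym (quantifierPrefix-prenex p qf)) (trans (cong quantifierPrefix e) (quantifierPrefix-prenex p′ qf′))
  , trans (sym (matrix-prenex p qf)) (trans (cong matrix e) (matrix-prenex p′ qf′))

atoms-prenex : ∀ p χ → atoms (prenex p χ) ≡ atoms χ
atoms-prenex []             χ = refl
atoms-prenex ((∀q , _) ∷ p) χ = atoms-prenex p χ
atoms-prenex ((∃q , _) ∷ p) χ = atoms-prenex p χ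

k≤step : ∀ q q′ k → k ≤ step q q′ k
k≤step ∃q ∀q k = n≤1+n k
k≤step ∃q ∃q k = ≤-refl
k≤step ∀q ∀q k = ≤-refl
k≤step ∀q ∃q k = ≤-refl

j≤numBlocks : ∀ j prev p → j ≤ numBlocks j prev p
j≤numBlocks j prev []            = ≤-refl
j≤numBlocks j prev ((q , _) ∷ p) = ≤-trans (k≤step prev q j) (j≤numBlocks _ q p)

annotate-index≥ : ∀ {q v k} j prev p → (q , v , k) ∈ annotate j prev p → j ≤ k
annotate-index≥ j prev ((q , _) ∷ p) (here refl) = k≤step prev q j
annotate-index≥ j prev ((q , _) ∷ p) (there m)   = ≤-trans (k≤step prev q j) (annotate-index≥ _ q p m)

annotate-index≤numBlocks : ∀ {q v k} j prev p → (q , v , k) ∈ annotate j prev p →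
                           k ≤ numBlocks j prev p
annotate-index≤numBlocks j prev ((q , _) ∷ p) (here refl) = j≤numBlocks _ q p
annotate-index≤numBlocks j prev ((q , _) ∷ p) (there m)   = annotate-index≤numBlocks _ q p m

annotate-∀⇒univVars : ∀ {v k} j prev p → (∀q , v , k) ∈ annotate j prev p → v ∈ univVars p
annotate-∀⇒univVars j prev ((∀q , _) ∷ p) (here refl) = here refl
annotate-∀⇒univVars j prev ((∀q , _) ∷ p) (there m)   = there (annotate-∀⇒univVars _ ∀q p m)
annotate-∀⇒univVars j prev ((∃q , _) ∷ p) (there m)   = annotate-∀⇒univVars _ ∃q p m

annotate-∃⇒existVars : ∀ {v k} j prev p → (∃q , v , k) ∈ annotate j prev p → v ∈ existVars p
annotate-∃⇒existVars j prev ((∃q , _) ∷ p) (here refl) = here refl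
annotate-∃⇒existVars j prev ((∃q , _) ∷ p) (there m)   = there (annotate-∃⇒existVars _ ∃q p m)
annotate-∃⇒existVars j prev ((∀q , _) ∷ p) (there m)   = annotate-∃⇒existVars _ ∀q p m

annotate-∀-after-∃ : ∀ {v k} j p → (∀q , v , k) ∈ annotate j ∃q p → suc j ≤ k
annotate-∀-after-∃ j ((∀q , _) ∷ p) (here refl) = ≤-refl
annotate-∀-after-∃ j ((∀q , _) ∷ p) (there m)   = annotate-index≥ (suc j) ∀q p m
annotate-∀-after-∃ j ((∃q , _) ∷ p) (there m)   = annotate-∀-after-∃ j p m

blockVar : Q × Var × ℕ → Var
blockVar (_ , v , _) = v

map-blockVar-annotate : ∀ j prev p → map blockVar (annotate j prev p) ≡ map proj₂ p
map-blockVar-annotate j prev []            = refl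
map-blockVar-annotate j prev ((q , v) ∷ p) = cong (v ∷_) (map-blockVar-annotate _ q p)

levelOf : Q → ℕ → ℕ
levelOf ∀q k = pred k
levelOf ∃q k = k

levelOf≤ : ∀ q k → levelOf q k ≤ k
levelOf≤ ∀q k = pred[n]≤n
levelOf≤ ∃q k = ≤-refl

lookupLevel : Var → List (Q × Var × ℕ) → ℕ
lookupLevel v [] = 0
lookupLevel v ((q , w , k) ∷ l) with v ≟ w
... | yes _ = levelOf q k
... | no _  = lookupLevel v l

level : Prefix → Var → ℕ
level p v = lookupLevel v (blockIndex p)

lookupLevel-∈ : ∀ {q v k} l → Unique (map blockVar l) → (q , v , k) ∈ l →
                lookupLevel v l ≡ levelOf q k
lookupLevel-∈ {v = v} (_ ∷ l) (_ ∷ _) (here refl) with v ≟ v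
... | yes _ = refl
... | no v≢v = ⊥-elim (v≢v refl)
lookupLevel-∈ {v = v} ((_ , w , _) ∷ l) (w∉l ∷ u) (there m) with v ≟ w
... | yes refl = ⊥-elim (All.lookup w∉l (∈-map⁺ blockVar m) refl)
... | no _     = lookupLevel-∈ l u m

lookupLevel≤ : ∀ v l B → (∀ {q w k} → (q , w , k) ∈ l → k ≤ B) → lookupLevel v l ≤ B
lookupLevel≤ v [] B _ = z≤n
lookupLevel≤ v ((q , w , k) ∷ l) B bound with v ≟ w
... | yes _ = ≤-trans (levelOf≤ q k) (bound (here refl))
... | no _  = lookupLevel≤ v l B (λ m → bound (there m))

level-blockIndex : ∀ {q v k} p → Unique (map proj₂ p) → (q , v , k) ∈ blockIndex p →
                   level p v ≡ levelOf q k
level-blockIndex p u =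
  lookupLevel-∈ (blockIndex p) (subst Unique (sym (map-blockVar-annotate 1 ∀q p)) u)

level≤blockCount : ∀ p v → level p v ≤ blockCount p
level≤blockCount p v = lookupLevel≤ v (blockIndex p) (blockCount p) (annotate-index≤numBlocks 1 ∀q p)

Homogeneous : Prefix → Atom → Set
Homogeneous p A = ∀ {v w} → v ∈ atomVars A → w ∈ atomVars A → level p v ≡ level p w

headLevel : Prefix → List Var → ℕ
headLevel p []      = 0
headLevel p (v ∷ _) = level p v

atomLevel : Prefix → Atom → ℕ
atomLevel p A = headLevel p (atomVars A)

headLevel-∈ : ∀ {p v} vs → (∀ {v w} → v ∈ vs → w ∈ vs → level p v ≡ level p w) → v ∈ vs →
              headLevel p vs ≡ level p v
headLevel-∈ (_ ∷ _) hom v∈vs = hom (here refl) v∈vs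

atomLevel≤blockCount : ∀ p A → atomLevel p A ≤ blockCount p
atomLevel≤blockCount p A with atomVars A
... | []    = z≤n
... | v ∷ _ = level≤blockCount p v

homogeneous⇒GBSRParts : ∀ p χ → Unique (map proj₂ p) → All (Homogeneous p) (atoms χ) →
                        GBSRParts p χ
homogeneous⇒GBSRParts p χ u hom =
  atomLevel p , (λ A _ → atomLevel≤blockCount p A) , condition-i , condition-ii
  where
  atomLevel≡ : ∀ {A v} → A ∈ atoms χ → v ∈ atomVars A → atomLevel p A ≡ level p v
  atomLevel≡ {A} A∈χ = headLevel-∈ (atomVars A) (All.lookup hom A∈χ)

  pred< : ∀ {k} → 1 ≤ k → pred k < k
  pred< {suc k} _ = ≤-refl

  condition-i : ∀ A → A ∈ atoms χ → ∀ v k → v ∈ atomVars A →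
                ((∀q , v , k) ∈ blockIndex p → atomLevel p A < k)
              × ((∃q , v , k) ∈ blockIndex p → k ≤ atomLevel p A)
  condition-i A A∈χ v k v∈A =
      (λ m → subst (_< k) (sym (trans (atomLevel≡ A∈χ v∈A) (level-blockIndex p u m)))
                   (pred< (annotate-index≥ 1 ∀q p m)))
    , (λ m → subst (k ≤_) (sym (trans (atomLevel≡ A∈χ v∈A) (level-blockIndex p u m))) ≤-refl)

  condition-ii : ∀ A B → A ∈ atoms χ → B ∈ atoms χ → ∀ v → v ∈ univVars p →
                 v ∈ atomVars A → v ∈ atomVars B → atomLevel p A ≡ atomLevel p B
  condition-ii A B A∈χ B∈χ v _ v∈A v∈B = trans (atomLevel≡ A∈χ v∈A) (sym (atomLevel≡ B∈χ v∈B))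

leading∃ : List Var → Prefix
leading∃ zs = map (λ z → (∃q , z)) zs

leadingLevel : List Var → ℕ
leadingLevel []      = 0
leadingLevel (_ ∷ _) = 1

leadingLevel≤1 : ∀ zs → leadingLevel zs ≤ 1
leadingLevel≤1 []      = z≤n
leadingLevel≤1 (_ ∷ _) = ≤-refl

univVars-leading∃ : ∀ zs rest → univVars (leading∃ zs ++ rest) ≡ univVars rest
univVars-leading∃ []       rest = refl
univVars-leading∃ (_ ∷ zs) rest = univVars-leading∃ zs rest

annotate-∃-leading∃ : ∀ {v k} j zs rest → (∃q , v , k) ∈ annotate j ∃q (leading∃ zs ++ rest) →
                      k ≡ j ⊎ v ∈ existVars rest
annotate-∃-leading∃ j []       rest m           = inj₂ (annotate-∃⇒existVars j ∃q rest m)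
annotate-∃-leading∃ j (_ ∷ zs) rest (here refl) = inj₁ refl
annotate-∃-leading∃ j (_ ∷ zs) rest (there m)   = annotate-∃-leading∃ j zs rest m

blockIndex-∀-leading∃ : ∀ {v k} zs rest → (∀q , v , k) ∈ blockIndex (leading∃ zs ++ rest) →
                        leadingLevel zs < k
blockIndex-∀-leading∃ []       rest m         = annotate-index≥ 1 ∀q rest m
blockIndex-∀-leading∃ (_ ∷ zs) rest (there m) = annotate-∀-after-∃ 1 (leading∃ zs ++ rest) m

blockIndex-∃-leading∃ : ∀ {v k} zs rest → v ∉ existVars rest →
                        (∃q , v , k) ∈ blockIndex (leading∃ zs ++ rest) → k ≤ leadingLevel zs
blockIndex-∃-leading∃ []       rest v∉ m           = ⊥-elim (v∉ (annotate-∃⇒existVars 1 ∀q rest m))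
blockIndex-∃-leading∃ (_ ∷ _)  rest v∉ (here refl) = ≤-refl
blockIndex-∃-leading∃ (_ ∷ zs) rest v∉ (there m) with annotate-∃-leading∃ 1 zs rest m
... | inj₁ refl = ≤-refl
... | inj₂ v∈   = ⊥-elim (v∉ v∈)

Separated : Prefix → Atom → Set
Separated rest A = (∀ v → v ∈ atomVars A → v ∉ univVars rest)
                 ⊎ (∀ v → v ∈ atomVars A → v ∉ existVars rest)

separated-universal⇒no-existential : ∀ {rest A} → Separated rest A →
  Any (_∈ univVars rest) (atomVars A) → ∀ v → v ∈ atomVars A → v ∉ existVars rest
separated-universal⇒no-existential (inj₂ no∃) _ = no∃
separated-universal⇒no-existential (inj₁ no∀) some∀ with find some∀
... | w , w∈A , w∈∀ = ⊥-elim (no∀ w w∈A w∈∀)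

separatedLabel : List Var → Prefix → Atom → ℕ
separatedLabel zs rest A with any? (_∈? univVars rest) (atomVars A)
... | yes _ = leadingLevel zs
... | no _  = blockCount (leading∃ zs ++ rest)

separated⇒GBSRParts : ∀ zs rest χ → All (Separated rest) (atoms χ) →
                      GBSRParts (leading∃ zs ++ rest) χ
separated⇒GBSRParts zs rest χ sep =
  separatedLabel zs rest , bound , condition-i , condition-ii
  where
  p = leading∃ zs ++ rest

  bound : ∀ A → A ∈ atoms χ → separatedLabel zs rest A ≤ blockCount p
  bound A _ with any? (_∈? univVars rest) (atomVars A)
  ... | yes _ = ≤-trans (leadingLevel≤1 zs) (j≤numBlocks 1 ∀q p)
  ... | no _  = ≤-refl

  condition-i : ∀ A → A ∈ atoms χ → ∀ v k → v ∈ atomVars A →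
                ((∀q , v , k) ∈ blockIndex p → separatedLabel zs rest A < k)
              × ((∃q , v , k) ∈ blockIndex p → k ≤ separatedLabel zs rest A)
  condition-i A A∈χ v k v∈A with any? (_∈? univVars rest) (atomVars A)
  ... | yes some∀ =
      blockIndex-∀-leading∃ zs rest
    , blockIndex-∃-leading∃ zs rest
        (separated-universal⇒no-existential {rest} {A} (All.lookup sep A∈χ) some∀ v v∈A)
  ... | no no∀ =
      (λ m → ⊥-elim (no∀ (lose v∈A (subst (v ∈_) (univVars-leading∃ zs rest)
                                                  (annotate-∀⇒univVars 1 ∀q p m)))))
    , annotate-index≤numBlocks 1 ∀q p

  condition-ii : ∀ A B → A ∈ atoms χ → B ∈ atoms χ → ∀ v → v ∈ univVars p →
                 v ∈ atomVars A → v ∈ atomVars B → separatedLabel zs rest A ≡ separatedLabel zs rest B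
  condition-ii A B _ _ v v∈∀ v∈A v∈B
    with any? (_∈? univVars rest) (atomVars A) | any? (_∈? univVars rest) (atomVars B)
  ... | yes _   | yes _   = refl
  ... | no no∀A | _       = ⊥-elim (no∀A (lose v∈A v∈∀rest))
    where v∈∀rest = subst (v ∈_) (univVars-leading∃ zs rest) v∈∀
  ... | _       | no no∀B = ⊥-elim (no∀B (lose v∈B v∈∀rest))
    where v∈∀rest = subst (v ∈_) (univVars-leading∃ zs rest) v∈∀

sf⇒gbsr : (φ : Formula) → StandardForm φ → SF φ → GBSR φ
sf⇒gbsr φ (p , χ , e , std) (zs , rest , χ′ , e′ , qf′ , _ , sep)
  with prenex-injective {p} {leading∃ zs ++ rest} (proj₁ std) qf′ (trans (sym e) e′)
... | refl , refl = p , χ , e , std , separated⇒GBSRParts zs rest χ sep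

leading∀ : List Var → Prefix
leading∀ vs = map (λ v → (∀q , v)) vs

∉existVars-leading∀ : ∀ vs v → v ∉ existVars (leading∀ vs)
∉existVars-leading∀ (_ ∷ vs) v m = ∉existVars-leading∀ vs v m

bsr⇒sf : (φ : Formula) → BSR φ → SF φ
bsr⇒sf φ (us , vs , χ , e , qf , closed) =
  us , leading∀ vs , χ , e , qf , closed ,
  All.universal (λ _ → inj₂ (λ v _ → ∉existVars-leading∀ vs v)) (atoms χ)

UnaryAtom : Atom → Set
UnaryAtom A = ∃[ P ] ∃[ x ] (A ≡ rel P (var x ∷ []))

unary⇒homogeneous : ∀ {p A} → UnaryAtom A → Homogeneous p A
unary⇒homogeneous (_ , _ , refl) (here refl) (here refl) = refl

monadic⇒gbsr : (φ : Formula) → StandardForm φ → Monadic φ → GBSR φ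
monadic⇒gbsr φ (p , χ , refl , std) (_ , unary) =
  p , χ , refl , std ,
  homogeneous⇒GBSRParts p χ (proj₁ (proj₂ (proj₂ std)))
    (All.map (unary⇒homogeneous {p}) (subst (All UnaryAtom) (atoms-prenex p χ) unary))

atomP atomR : Atom
atomP = rel 0 (var 0 ∷ [])
atomR = rel 1 (var 1 ∷ var 2 ∷ [])

χ₀ : Formula
χ₀ = and (atom atomP) (atom atomR)

p₀ : Prefix
p₀ = (∀q , 0) ∷ (∃q , 1) ∷ (∀q , 2) ∷ []

φ₀ : Formula
φ₀ = prenex p₀ χ₀

unique₀ : Unique (map proj₂ p₀)
unique₀ = ((λ ()) ∷ (λ ()) ∷ []) ∷ ((λ ()) ∷ []) ∷ [] ∷ []

closed₀ : Closed φ₀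
closed₀ x (allF x≢0 (exF _ (allF _ (andL (atomF (here refl))))))          = x≢0 refl
closed₀ x (allF _ (exF x≢1 (allF _ (andR (atomF (here refl))))))          = x≢1 refl
closed₀ x (allF _ (exF _ (allF x≢2 (andR (atomF (there (here refl))))))) = x≢2 refl

std₀ : StdParts p₀ χ₀
std₀ = (tt , tt) , (tt , tt) , unique₀
     , (here refl ∷ there (here refl) ∷ there (there (here refl)) ∷ [])
     , closed₀

homogeneousR : Homogeneous p₀ atomR
homogeneousR (here refl)         (here refl)         = refl
homogeneousR (here refl)         (there (here refl)) = refl
homogeneousR (there (here refl)) (here refl)         = refl
homogeneousR (there (here refl)) (there (here refl)) = refl

gbsr₀ : GBSR φ₀
gbsr₀ = p₀ , χ₀ , refl , std₀ ,
  homogeneous⇒GBSRParts p₀ χ₀ unique₀ (unary⇒homogeneous (0 , 0 , refl) ∷ homogeneousR ∷ [])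

¬sf₀ : ¬ SF φ₀
¬sf₀ (zs , rest , χ , e , qf , _ , _)
  with prenex-injective {p₀} {leading∃ zs ++ rest} (tt , tt) qf e
¬sf₀ ([] , _ , _ , _ , _ , _ , _ ∷ inj₁ no∀ ∷ _) | refl , refl = no∀ 2 (there (here refl)) (there (here refl))
¬sf₀ ([] , _ , _ , _ , _ , _ , _ ∷ inj₂ no∃ ∷ _) | refl , refl = no∃ 1 (here refl) (here refl)
¬sf₀ (_ ∷ _ , _ , _ , _ , _ , _ , _)              | () , _

¬bsr₀ : ¬ BSR φ₀
¬bsr₀ (us , vs , χ , e , qf , _)
  with prenex-injective {p₀} {leading∃ us ++ leading∀ vs} (tt , tt) qf e
¬bsr₀ ([] , _ ∷ _ ∷ _ , _ , _ , _ , _) | () , _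
¬bsr₀ (_ ∷ _ , _ , _ , _ , _ , _)      | () , _

¬monadic₀ : ¬ Monadic φ₀
¬monadic₀ (_ , _ ∷ (_ , _ , ()) ∷ _)

proposition1 : ((φ : Formula) → StandardForm φ → SF φ → GBSR φ)
    × ((φ : Formula) → StandardForm φ → BSR φ → GBSR φ)
    × ((φ : Formula) → StandardForm φ → Monadic φ → GBSR φ)
    × (∃[ φ ] (GBSR φ × ¬ SF φ × ¬ BSR φ × ¬ Monadic φ))
proposition1 =
    sf⇒gbsr
  , (λ φ std bsr → sf⇒gbsr φ std (bsr⇒sf φ bsr))
  , monadic⇒gbsr
  , (φ₀ , gbsr₀ , ¬sf₀ , ¬bsr₀ , ¬monadic₀)
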